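{- Let $\mathcal{SP}$ be the class of split graphs. For all positive integers $i,j$ and nonnegative integers $k$ such that $(i-k-2)(j-k-2)\geq(k+1)^2$, we have $R_k^{\mathcal{SP}}(i,j)=i+j-1$.
   Context: All graphs are finite and simple. A graph is split if its vertex set can be partitioned into a clique and an independent set. For a graph $G$ and an integer $k\ge 0$, a $k$-sparse $j$-set is a set of exactly $j$ vertices of $G$ inducing a subgraph of maximum degree at most $k$; a $k$-dense $i$-set is a set of exactly $i$ vertices that is $k$-sparse in the complement of $G$. For a graph class $\mathcal{G}$, $R_k^{\mathcal{G}}(i,j)$ is the smallest natural number $n$ such that every graph on $n$ vertices in $\mathcal{G}$ has a $k$-dense $i$-set or a $k$-sparse $j$-set. -}

module Defs where

open import Data.Nat using (ℕ; _≤_; _<_)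
open import Data.Bool using (Bool; true; false; not)
open import Data.Fin using (Fin; _≟_)
open import Data.Fin.Subset using (Subset; _∈_; _∉_; _∩_; ∣_∣)
open import Data.Vec using (tabulate)
open import Data.Product using (Σ; _×_)
open import Data.Sum using (_⊎_)
open import Relation.Nullary using (¬_; yes; no)
open import Relation.Binary.PropositionalEquality using (_≡_; _≢_)

record Graph (n : ℕ) : Set where
  field
    adj   : Fin n → Fin n → Bool
    sym   : ∀ u v → adj u v ≡ adj v u
    irrfl : ∀ v → adj v v ≡ false
open Graph public

complement : ∀ {n} → Graph n → Graph n
complement {n} G = record { adj = a ; sym = s ; irrfl = r }
  where
  a : Fin n → Fin n → Bool
  a u v with u ≟ v
  ... | yes _ = false
  ... | no  _ = not (adj G u v)
  s : ∀ u v → a u v ≡ a v u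
  s u v with u ≟ v | v ≟ u
  ... | yes _ | yes _ = _≡_.refl
  ... | yes p | no ¬q = Data.Empty.⊥-elim (¬q (Relation.Binary.PropositionalEquality.sym p))
    where import Data.Empty
  ... | no ¬p | yes q = Data.Empty.⊥-elim (¬p (Relation.Binary.PropositionalEquality.sym q))
    where import Data.Empty
  ... | no _  | no _  = Relation.Binary.PropositionalEquality.cong not (sym G u v)
  r : ∀ v → a v v ≡ false
  r v with v ≟ v
  ... | yes _ = _≡_.refl
  ... | no ¬p = Data.Empty.⊥-elim (¬p _≡_.refl)
    where import Data.Empty

nbhd : ∀ {n} → Graph n → Fin n → Subset n
nbhd G v = tabulate (adj G v)

degIn : ∀ {n} → Graph n → Subset n → Fin n → ℕ
degIn G S v = ∣ S ∩ nbhd G v ∣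

MaxDegLe : ∀ {n} → Graph n → Subset n → ℕ → Set
MaxDegLe G S k = ∀ v → v ∈ S → degIn G S v ≤ k

SparseSet : ∀ {n} → Graph n → ℕ → ℕ → Subset n → Set
SparseSet G k j S = (∣ S ∣ ≡ j) × MaxDegLe G S k

DenseSet : ∀ {n} → Graph n → ℕ → ℕ → Subset n → Set
DenseSet G k i S = SparseSet (complement G) k i S

IsSplit : ∀ {n} → Graph n → Set
IsSplit {n} G = Σ (Subset n) λ K →
  (∀ u v → u ∈ K → v ∈ K → u ≢ v → adj G u v ≡ true) ×
  (∀ u v → u ∉ K → v ∉ K → adj G u v ≡ false)

SplitRamseyProperty : ℕ → ℕ → ℕ → ℕ → Set
SplitRamseyProperty k i j n = (G : Graph n) → IsSplit G →
  Σ (Subset n) (DenseSet G k i) ⊎ Σ (Subset n) (SparseSet G k j)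

SplitRamseyNumberIs : ℕ → ℕ → ℕ → ℕ → Set
SplitRamseyNumberIs k i j N =
  SplitRamseyProperty k i j N × (∀ m → m < N → ¬ SplitRamseyProperty k i j m)

-- A split graph on i + j - 1 vertices has a clique of size at least i or an
-- independent set of size at least j, which are 0-dense and 0-sparse.
--
-- For the lower bound write d = k + 1, i = a + 1 and j = b + 1 with a = d + α and
-- b = d + β, so that the hypothesis reads d² ≤ α β, equivalently a d ≤ α b. Take a
-- clique x₀, …, x_{a-1} and an independent set y₀, …, y_{b-1}, and join x to the d
-- vertices y_t with t ≡ x d + r (mod b), r < d. Every clique vertex then misses
-- exactly β vertices y, and since the blocks [x d, x d + d) are disjoint and lie in
-- [0, a d) ⊆ [0, α b), every y has at most α neighbours x. A k-sparse set containing
-- a clique vertex x consists of x, at most k neighbours of x and at most β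
-- non-neighbours y, so it has at most b elements, as does a k-sparse set inside the
-- independent set; dually every k-dense set has at most a elements.
--
-- The integer hypothesis forces either i, j ≥ k + 2, or i = j = 1, where the claim
-- is trivial.

module Submission where

open import Data.Bool using (Bool; true; false; not)
open import Data.Empty using (⊥-elim)
open import Data.Fin using (Fin; toℕ; _≟_)
import Data.Fin as Fin
open import Data.Fin.Properties using (toℕ<n; toℕ-injective; any?)
open import Data.Fin.Subset using (Subset; _∈_; _∉_; _⊆_; _∩_; _∪_; ∁; ⁅_⁆; ∣_∣)
  renaming (⊥ to ∅)
open import Data.Fin.Subset.Properties
  using (_∈?_; ∉⊥; ∣⊥∣≡0; ∣p∣≤∣x∷p∣; ∣⁅x⁆∣≡1; ∣∁p∣≡n∸∣p∣; p⊆q⇒∣p∣≤∣q∣; in⊆in; out⊆; x∈⁅x⁆;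
         x∈p∩q⁺; x∈p∩q⁻; x∈p∪q⁺; x∈∁p⇒x∉p; x∉p⇒x∈∁p; x∉∁p⇒x∈p)
open import Data.Nat using (ℕ; zero; suc; _+_; _∸_; _≤_; _<_; z≤n; s≤s; _≤?_; _<?_)
import Data.Nat as ℕ
open import Data.Nat.Properties hiding (_≟_)
open import Data.Product using (∃; ∃-syntax; _×_; _,_)
import Data.Product as Product
open import Data.Sum using (_⊎_; inj₁; inj₂; [_,_]′)
import Data.Sum as Sum
open import Data.Vec using ([]; _∷_; tabulate; here; there)
open import Data.Vec.Properties using (lookup∘tabulate; []=⇒lookup; lookup⇒[]=)
open import Function using (_∘_)
open import Function.Bundles using (mk⇔)
open import Relation.Binary.PropositionalEquality
  using (_≡_; _≢_; refl; sym; trans; cong; cong₂; subst; subst₂; module ≡-Reasoning)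
open import Relation.Nullary using (¬_; Dec; yes; no; does)
open import Relation.Nullary.Decidable using (dec-true; dec-false; does-⇔; _×-dec_; _⊎-dec_; ¬?)
open import Relation.Unary using (Pred; Decidable)

open import Defs hiding (sym)

∣p∪q∣≤∣p∣+∣q∣ : ∀ {n} (p q : Subset n) → ∣ p ∪ q ∣ ≤ ∣ p ∣ + ∣ q ∣
∣p∪q∣≤∣p∣+∣q∣ []          []          = z≤n
∣p∪q∣≤∣p∣+∣q∣ (true  ∷ p) (s     ∷ q) =
  s≤s (≤-trans (∣p∪q∣≤∣p∣+∣q∣ p q) (+-monoʳ-≤ ∣ p ∣ (∣p∣≤∣x∷p∣ s q)))
∣p∪q∣≤∣p∣+∣q∣ (false ∷ p) (true  ∷ q) =
  ≤-trans (s≤s (∣p∪q∣≤∣p∣+∣q∣ p q)) (≤-reflexive (sym (+-suc ∣ p ∣ ∣ q ∣)))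
∣p∪q∣≤∣p∣+∣q∣ (false ∷ p) (false ∷ q) = ∣p∪q∣≤∣p∣+∣q∣ p q

∣p∣≤∣p∩q∣+∣p∩∁q∣ : ∀ {n} (p q : Subset n) → ∣ p ∣ ≤ ∣ p ∩ q ∣ + ∣ p ∩ ∁ q ∣
∣p∣≤∣p∩q∣+∣p∩∁q∣ []          []          = z≤n
∣p∣≤∣p∩q∣+∣p∩∁q∣ (true  ∷ p) (true  ∷ q) = s≤s (∣p∣≤∣p∩q∣+∣p∩∁q∣ p q)
∣p∣≤∣p∩q∣+∣p∩∁q∣ (true  ∷ p) (false ∷ q) =
  ≤-trans (s≤s (∣p∣≤∣p∩q∣+∣p∩∁q∣ p q)) (≤-reflexive (sym (+-suc ∣ p ∩ q ∣ ∣ p ∩ ∁ q ∣)))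
∣p∣≤∣p∩q∣+∣p∩∁q∣ (false ∷ p) (_     ∷ q) = ∣p∣≤∣p∩q∣+∣p∩∁q∣ p q

increasing⇒∣p∣≤u∸l : ∀ {n} (p : Subset n) (R : Fin n → ℕ → Set) {l u} →
  (∀ {w} → w ∈ p → ∃[ q ] R w q × l ≤ q × q < u) →
  (∀ {w w′ q q′} → w ∈ p → w′ ∈ p → toℕ w < toℕ w′ → R w q → R w′ q′ → q < q′) →
  ∣ p ∣ ≤ u ∸ l
increasing⇒∣p∣≤u∸l []          R witness increasing = z≤n
increasing⇒∣p∣≤u∸l (false ∷ p) R witness increasing =
  increasing⇒∣p∣≤u∸l p (R ∘ Fin.suc) (witness ∘ there)
    (λ w∈p w′∈p w<w′ → increasing (there w∈p) (there w′∈p) (s≤s w<w′))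
increasing⇒∣p∣≤u∸l (true  ∷ p) R {l} {u} witness increasing with witness here
... | q , r , l≤q , q<u = begin
  suc ∣ p ∣        ≤⟨ s≤s (increasing⇒∣p∣≤u∸l p (R ∘ Fin.suc) witness′
                         (λ w∈p w′∈p w<w′ → increasing (there w∈p) (there w′∈p) (s≤s w<w′))) ⟩
  suc (u ∸ suc q)  ≡⟨ +-∸-assoc 1 q<u ⟨
  u ∸ q            ≤⟨ ∸-monoʳ-≤ u l≤q ⟩
  u ∸ l            ∎
  where
  open ≤-Reasoning
  witness′ : ∀ {w} → w ∈ p → ∃[ q′ ] R (Fin.suc w) q′ × suc q ≤ q′ × q′ < u
  witness′ w∈p with witness (there w∈p)
  ... | q′ , r′ , _ , q′<u = q′ , r′ , increasing here (there w∈p) (s≤s z≤n) r r′ , q′<u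

toℕ-range⇒∣p∣≤u∸l : ∀ {n} (p : Subset n) {l u} →
  (∀ {w} → w ∈ p → l ≤ toℕ w × toℕ w < u) → ∣ p ∣ ≤ u ∸ l
toℕ-range⇒∣p∣≤u∸l p range = increasing⇒∣p∣≤u∸l p (λ w q → toℕ w ≡ q)
  (λ {w} w∈p → toℕ w , refl , range w∈p) (λ { _ _ w<w′ refl refl → w<w′ })

⊆-ofSize : ∀ {n i} (p : Subset n) → i ≤ ∣ p ∣ → ∃[ q ] q ⊆ p × ∣ q ∣ ≡ i
⊆-ofSize {n} {zero} p           _         = ∅ , (λ x∈∅ → ⊥-elim (∉⊥ x∈∅)) , ∣⊥∣≡0 n
⊆-ofSize {i = suc i} (true  ∷ p) (s≤s i≤p) with ⊆-ofSize p i≤p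
... | q , q⊆p , ∣q∣≡i = true ∷ q , in⊆in q⊆p , cong suc ∣q∣≡i
⊆-ofSize {i = suc i} (false ∷ p) i<p       with ⊆-ofSize p i<p
... | q , q⊆p , ∣q∣≡i = false ∷ q , out⊆ q⊆p , ∣q∣≡i

x∈tabulate⁺ : ∀ {n} {f : Fin n → Bool} {x} → f x ≡ true → x ∈ tabulate f
x∈tabulate⁺ {f = f} {x} fx≡true = lookup⇒[]= x (tabulate f) (trans (lookup∘tabulate f x) fx≡true)

x∈tabulate⁻ : ∀ {n} {f : Fin n → Bool} {x} → x ∈ tabulate f → f x ≡ true
x∈tabulate⁻ {f = f} {x} x∈f = trans (sym (lookup∘tabulate f x)) ([]=⇒lookup x∈f)

module _ {n p} {P : Pred (Fin n) p} (P? : Decidable P) where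

  x∈tabulate-does⁺ : ∀ {x} → P x → x ∈ tabulate (does ∘ P?)
  x∈tabulate-does⁺ {x} px = x∈tabulate⁺ (dec-true (P? x) px)

  x∈tabulate-does⁻ : ∀ {x} → x ∈ tabulate (does ∘ P?) → P x
  x∈tabulate-does⁻ {x} x∈P with P? x | x∈tabulate⁻ {f = does ∘ P?} x∈P
  ... | yes px | _ = px

below : ∀ {n} → ℕ → Subset n
below t = tabulate (does ∘ λ w → toℕ w <? t)

∈below⁺ : ∀ {n t} {w : Fin n} → toℕ w < t → w ∈ below t
∈below⁺ {t = t} = x∈tabulate-does⁺ (λ w → toℕ w <? t)

∈below⁻ : ∀ {n t} {w : Fin n} → w ∈ below t → toℕ w < t
∈below⁻ {t = t} = x∈tabulate-does⁻ (λ w → toℕ w <? t)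

∉below⇒≥ : ∀ {n t} {w : Fin n} → w ∉ below t → t ≤ toℕ w
∉below⇒≥ w∉below = ≮⇒≥ (w∉below ∘ ∈below⁺)

IsClique : ∀ {n} → Graph n → Subset n → Set
IsClique G C = ∀ u v → u ∈ C → v ∈ C → u ≢ v → adj G u v ≡ true

IsIndependent : ∀ {n} → Graph n → Subset n → Set
IsIndependent G I = ∀ u v → u ∈ I → v ∈ I → adj G u v ≡ false

module _ {n} (G : Graph n) where

  complement-adj : ∀ {u v} → u ≢ v → adj (complement G) u v ≡ not (adj G u v)
  complement-adj {u} {v} u≢v with u ≟ v
  ... | yes u≡v = ⊥-elim (u≢v u≡v)
  ... | no  _   = refl

  ∉nbhd-complement⇒∈nbhd : ∀ {u v} → u ≢ v → v ∉ nbhd (complement G) u → v ∈ nbhd G u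
  ∉nbhd-complement⇒∈nbhd {u} {v} u≢v v∉ with adj G u v in uv
  ... | true  = x∈tabulate⁺ uv
  ... | false = ⊥-elim (v∉ (x∈tabulate⁺ (trans (complement-adj u≢v) (cong not uv))))

  isClique⇒isIndependent-complement : ∀ {C} → IsClique G C → IsIndependent (complement G) C
  isClique⇒isIndependent-complement clique u v u∈C v∈C with u ≟ v
  ... | yes _    = refl
  ... | no  u≢v  = cong not (clique u v u∈C v∈C u≢v)

  isIndependent⇒isClique-complement : ∀ {I} → IsIndependent G I → IsClique (complement G) I
  isIndependent⇒isClique-complement independent u v u∈I v∈I u≢v =
    trans (complement-adj u≢v) (cong not (independent u v u∈I v∈I))

  ∁-isIndependent : ∀ {K} → (∀ u v → u ∉ K → v ∉ K → adj G u v ≡ false) → IsIndependent G (∁ K)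
  ∁-isIndependent independent u v u∈∁K v∈∁K = independent u v (x∈∁p⇒x∉p u∈∁K) (x∈∁p⇒x∉p v∈∁K)

  isIndependent⇒maxDegLe : ∀ {S} k → IsIndependent G S → MaxDegLe G S k
  isIndependent⇒maxDegLe {S} k independent v v∈S = begin
    ∣ S ∩ nbhd G v ∣  ≤⟨ p⊆q⇒∣p∣≤∣q∣ S∩nbhd⊆∅ ⟩
    ∣ ∅ {n} ∣          ≡⟨ ∣⊥∣≡0 n ⟩
    0                  ≤⟨ z≤n ⟩
    k                  ∎
    where
    open ≤-Reasoning
    S∩nbhd⊆∅ : S ∩ nbhd G v ⊆ ∅
    S∩nbhd⊆∅ {w} w∈ with x∈p∩q⁻ S (nbhd G v) w∈
    ... | w∈S , w∈nbhd with () ← trans (sym (x∈tabulate⁻ w∈nbhd)) (independent v w v∈S w∈S)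

  -- A k-sparse set S meeting C in v lies in {v} ∪ (S ∩ N(v)) ∪ (∁ C ∖ N(v)), as C is a clique.
  maxDegLe⇒∣S∣≤1+k+β : ∀ {C S k β} → IsClique G C → ∣ ∁ C ∣ ≤ suc (k + β) →
    (∀ {v} → v ∈ C → ∣ ∁ C ∩ ∁ (nbhd G v) ∣ ≤ β) → MaxDegLe G S k → ∣ S ∣ ≤ suc (k + β)
  maxDegLe⇒∣S∣≤1+k+β {C} {S} {k} {β} clique ∣∁C∣≤ nonNeighbours≤ maxDeg
    with any? (λ v → v ∈? S ×-dec v ∈? C)
  ... | no ∄v = ≤-trans (p⊆q⇒∣p∣≤∣q∣ S⊆∁C) ∣∁C∣≤
    where
    S⊆∁C : S ⊆ ∁ C
    S⊆∁C {w} w∈S = x∉p⇒x∈∁p (λ w∈C → ∄v (w , w∈S , w∈C))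
  ... | yes (v , v∈S , v∈C) = begin
    ∣ S ∣                  ≤⟨ p⊆q⇒∣p∣≤∣q∣ cover ⟩
    ∣ ⁅ v ⁆ ∪ N ∪ M ∣      ≤⟨ ∣p∪q∣≤∣p∣+∣q∣ ⁅ v ⁆ (N ∪ M) ⟩
    ∣ ⁅ v ⁆ ∣ + ∣ N ∪ M ∣  ≤⟨ +-mono-≤ (≤-reflexive (∣⁅x⁆∣≡1 v)) (∣p∪q∣≤∣p∣+∣q∣ N M) ⟩
    1 + (∣ N ∣ + ∣ M ∣)    ≤⟨ s≤s (+-mono-≤ (maxDeg v v∈S) (nonNeighbours≤ v∈C)) ⟩
    suc (k + β)            ∎
    where
    open ≤-Reasoning
    N = S ∩ nbhd G v
    M = ∁ C ∩ ∁ (nbhd G v)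
    cover : S ⊆ ⁅ v ⁆ ∪ N ∪ M
    cover {w} w∈S with w ≟ v | adj G v w in vw
    ... | yes refl | _     = x∈p∪q⁺ (inj₁ (x∈⁅x⁆ v))
    ... | no  w≢v  | true  = x∈p∪q⁺ (inj₂ (x∈p∪q⁺ (inj₁ (x∈p∩q⁺ (w∈S , x∈tabulate⁺ vw)))))
    ... | no  w≢v  | false = x∈p∪q⁺ (inj₂ (x∈p∪q⁺ (inj₂ (x∈p∩q⁺ (x∉p⇒x∈∁p w∉C , x∉p⇒x∈∁p w∉nbhd)))))
      where
      w∉C : w ∉ C
      w∉C w∈C with () ← trans (sym vw) (clique v w v∈C w∈C (w≢v ∘ sym))
      w∉nbhd : w ∉ nbhd G v
      w∉nbhd w∈nbhd with () ← trans (sym vw) (x∈tabulate⁻ w∈nbhd)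

  isIndependent⇒sparseSet : ∀ {I j} k → IsIndependent G I → j ≤ ∣ I ∣ → ∃ (SparseSet G k j)
  isIndependent⇒sparseSet k independent j≤∣I∣ with ⊆-ofSize _ j≤∣I∣
  ... | S , S⊆I , ∣S∣≡j =
    S , ∣S∣≡j , isIndependent⇒maxDegLe k (λ u v u∈S v∈S → independent u v (S⊆I u∈S) (S⊆I v∈S))

isClique⇒denseSet : ∀ {n} (G : Graph n) {C i} k → IsClique G C → i ≤ ∣ C ∣ → ∃ (DenseSet G k i)
isClique⇒denseSet G k = isIndependent⇒sparseSet (complement G) k ∘ isClique⇒isIndependent-complement G

∣p∣≤i⇒j≤∣∁p∣ : ∀ {i j} (p : Subset (i + j)) → ∣ p ∣ ≤ i → j ≤ ∣ ∁ p ∣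
∣p∣≤i⇒j≤∣∁p∣ {i} {j} p ∣p∣≤i = begin
  j              ≡⟨ m+n∸m≡n i j ⟨
  i + j ∸ i      ≤⟨ ∸-monoʳ-≤ (i + j) ∣p∣≤i ⟩
  i + j ∸ ∣ p ∣  ≡⟨ ∣∁p∣≡n∸∣p∣ p ⟨
  ∣ ∁ p ∣        ∎
  where open ≤-Reasoning

splitRamseyProperty-upper : ∀ k i j → 1 ≤ i → SplitRamseyProperty k i j (i + j ∸ 1)
splitRamseyProperty-upper k (suc i) j _ G (K , clique , independent) with suc i ≤? ∣ K ∣
... | yes 1+i≤∣K∣ = inj₁ (isClique⇒denseSet G k clique 1+i≤∣K∣)
... | no  1+i≰∣K∣ = inj₂ (isIndependent⇒sparseSet G k (∁-isIndependent G independent)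
                           (∣p∣≤i⇒j≤∣∁p∣ K (≤-pred (≰⇒> 1+i≰∣K∣))))

m∸[m∸n]+[n∸m]≡n : ∀ m n → m ∸ (m ∸ n) + (n ∸ m) ≡ n
m∸[m∸n]+[n∸m]≡n m n with ≤-total n m
... | inj₁ n≤m = trans (cong₂ _+_ (m∸[m∸n]≡n n≤m) (m≤n⇒m∸n≡0 n≤m)) (+-identityʳ n)
... | inj₂ m≤n = trans (cong (_+ (n ∸ m)) (cong (m ∸_) (m≤n⇒m∸n≡0 m≤n))) (m+[n∸m]≡n m≤n)

-- Vertices 0, …, a - 1 form the clique and a + y, for y < b, the independent set.
-- The clique vertex x is joined to the independent vertices y lying in the cyclic
-- interval base x, …, base x + d - 1 modulo b.
module Construction (k α β : ℕ) (d²≤αβ : suc k ℕ.* suc k ≤ α ℕ.* β) where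

  open import Data.Nat using (_*_; _%_; _/_)
  open import Data.Nat.DivMod using (m≡m%n+[m/n]*n; m%n<n)

  d a b : ℕ
  d = suc k
  a = d + α
  b = d + β

  base : ℕ → ℕ
  base x = x * d % b

  Linked : ℕ → ℕ → Set
  Linked x y = base x ≤ y × y < base x + d ⊎ y + b < base x + d

  linked? : ∀ x y → Dec (Linked x y)
  linked? x y = (base x ≤? y ×-dec y <? base x + d) ⊎-dec y + b <? base x + d

  Slot : ℕ → ℕ → ℕ → Set
  Slot y x q = x * d ≤ q * b + y × q * b + y < suc x * d

  -- x d = (x d / b) b + base x, so adding (x d / b) b to base x, …, base x + d - 1 gives the block of x.
  slot-of-shift : ∀ {x y} q z → base x ≤ z → z < base x + d →
    q * b + y ≡ x * d / b * b + z → Slot y x q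
  slot-of-shift {x} {y} q z c≤z z<c+d qb+y≡Q+z = lower , upper
    where
    open ≤-Reasoning
    Q = x * d / b * b
    x*d≡Q+c : x * d ≡ Q + base x
    x*d≡Q+c = trans (m≡m%n+[m/n]*n (x * d) b) (+-comm (base x) Q)
    lower = begin
      x * d       ≡⟨ x*d≡Q+c ⟩
      Q + base x  ≤⟨ +-monoʳ-≤ Q c≤z ⟩
      Q + z       ≡⟨ qb+y≡Q+z ⟨
      q * b + y   ∎
    upper = begin-strict
      q * b + y         ≡⟨ qb+y≡Q+z ⟩
      Q + z             <⟨ +-monoʳ-< Q z<c+d ⟩
      Q + (base x + d)  ≡⟨ +-assoc Q (base x) d ⟨
      Q + base x + d    ≡⟨ cong (_+ d) x*d≡Q+c ⟨
      x * d + d         ≡⟨ +-comm (x * d) d ⟩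
      suc x * d         ∎

  linked⇒slot : ∀ {x y} → Linked x y → ∃[ q ] Slot y x q
  linked⇒slot {x} {y} (inj₁ (c≤y , y<c+d)) =
    x * d / b , slot-of-shift {x} {y} (x * d / b) y c≤y y<c+d refl
  linked⇒slot {x} {y} (inj₂ y+b<c+d) =
    suc (x * d / b) , slot-of-shift {x} {y} (suc (x * d / b)) (y + b) c≤y+b y+b<c+d b+Q+y≡Q+[y+b]
    where
    Q = x * d / b * b
    c≤y+b : base x ≤ y + b
    c≤y+b = ≤-trans (<⇒≤ (m%n<n (x * d) b)) (m≤n+m b y)
    b+Q+y≡Q+[y+b] : b + Q + y ≡ Q + (y + b)
    b+Q+y≡Q+[y+b] = trans (cong (_+ y) (+-comm b Q)) (trans (+-assoc Q b y) (cong (Q +_) (+-comm b y)))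

  slot-increasing : ∀ {y x x′ q q′} → x < x′ → Slot y x q → Slot y x′ q′ → q < q′
  slot-increasing {y} {x} {x′} {q} {q′} x<x′ (_ , qb+y<) (x′d≤ , _) =
    *-cancelʳ-< b q q′ (+-cancelʳ-< y (q * b) (q′ * b) (begin-strict
      q * b + y   <⟨ qb+y< ⟩
      suc x * d   ≤⟨ *-monoˡ-≤ d x<x′ ⟩
      x′ * d      ≤⟨ x′d≤ ⟩
      q′ * b + y  ∎))
    where open ≤-Reasoning

  a*d≤α*b : a * d ≤ α * b
  a*d≤α*b = begin
    (d + α) * d    ≡⟨ *-distribʳ-+ d d α ⟩
    d * d + α * d  ≤⟨ +-monoˡ-≤ (α * d) d²≤αβ ⟩
    α * β + α * d  ≡⟨ +-comm (α * β) (α * d) ⟩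
    α * d + α * β  ≡⟨ *-distribˡ-+ α d β ⟨
    α * (d + β)    ∎
    where open ≤-Reasoning

  slot<α : ∀ {y x q} → x < a → Slot y x q → q < α
  slot<α {y} {x} {q} x<a (_ , qb+y<) = *-cancelʳ-< b q α (begin-strict
    q * b      ≤⟨ m≤m+n (q * b) y ⟩
    q * b + y  <⟨ qb+y< ⟩
    suc x * d  ≤⟨ *-monoˡ-≤ d x<a ⟩
    a * d      ≤⟨ a*d≤α*b ⟩
    α * b      ∎)
    where open ≤-Reasoning

  ¬linked⇒gap : ∀ {x y} → ¬ Linked x y → base x ∸ β ≤ y × y < base x ⊎ d + base x ≤ y
  ¬linked⇒gap {x} {y} ¬linked with y <? base x
  ... | yes y<c = inj₁ (c∸β≤y , y<c)
    where
    c+d≤b+y : base x + d ≤ b + y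
    c+d≤b+y = subst (base x + d ≤_) (+-comm y b) (≮⇒≥ (¬linked ∘ inj₂))
    c∸β≤y : base x ∸ β ≤ y
    c∸β≤y = subst (_≤ y) (trans (cong (_∸ b) (+-comm (base x) d)) ([m+n]∸[m+o]≡n∸o d (base x) β))
              (m≤n+o⇒m∸n≤o (base x + d) b c+d≤b+y)
  ... | no  y≮c =
    inj₂ (subst (_≤ y) (+-comm (base x) d) (≮⇒≥ (λ y<c+d → ¬linked (inj₁ (≮⇒≥ y≮c , y<c+d)))))

  Joined : ℕ → ℕ → Set
  Joined x z = x < a × a ≤ z × Linked x (z ∸ a)

  Adjacent : ℕ → ℕ → Set
  Adjacent u v = u < a × v < a × u ≢ v ⊎ Joined u v ⊎ Joined v u

  joined? : ∀ x z → Dec (Joined x z)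
  joined? x z = x <? a ×-dec a ≤? z ×-dec linked? x (z ∸ a)

  adjacent? : ∀ u v → Dec (Adjacent u v)
  adjacent? u v = (u <? a ×-dec v <? a ×-dec ¬? (u ℕ.≟ v)) ⊎-dec joined? u v ⊎-dec joined? v u

  adjacent-sym : ∀ {u v} → Adjacent u v → Adjacent v u
  adjacent-sym (inj₁ (u<a , v<a , u≢v)) = inj₁ (v<a , u<a , u≢v ∘ sym)
  adjacent-sym (inj₂ (inj₁ joined))    = inj₂ (inj₂ joined)
  adjacent-sym (inj₂ (inj₂ joined))    = inj₂ (inj₁ joined)

  adjacent⇒<a : ∀ {u v} → Adjacent u v → u < a ⊎ v < a
  adjacent⇒<a (inj₁ (u<a , _))          = inj₁ u<a
  adjacent⇒<a (inj₂ (inj₁ (u<a , _)))   = inj₁ u<a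
  adjacent⇒<a (inj₂ (inj₂ (v<a , _)))   = inj₂ v<a

  adjacent⇒joined : ∀ {u v} → a ≤ u → Adjacent u v → Joined v u
  adjacent⇒joined a≤u (inj₁ (u<a , _))        = ⊥-elim (<⇒≱ u<a a≤u)
  adjacent⇒joined a≤u (inj₂ (inj₁ (u<a , _))) = ⊥-elim (<⇒≱ u<a a≤u)
  adjacent⇒joined a≤u (inj₂ (inj₂ joined))    = joined

  adjacent-irrefl : ∀ {u} → ¬ Adjacent u u
  adjacent-irrefl (inj₁ (_ , _ , u≢u))        = u≢u refl
  adjacent-irrefl (inj₂ (inj₁ (u<a , a≤u , _))) = <⇒≱ u<a a≤u
  adjacent-irrefl (inj₂ (inj₂ (u<a , a≤u , _))) = <⇒≱ u<a a≤u

  graph : (m : ℕ) → Graph m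
  graph m = record
    { adj   = λ u v → does (adjacent? (toℕ u) (toℕ v))
    ; sym   = λ u v → does-⇔ (mk⇔ adjacent-sym adjacent-sym)
                               (adjacent? (toℕ u) (toℕ v)) (adjacent? (toℕ v) (toℕ u))
    ; irrfl = λ v → dec-false (adjacent? (toℕ v) (toℕ v)) adjacent-irrefl
    }

  module _ {m : ℕ} where

    ∈nbhd⁺ : ∀ {v w} → Adjacent (toℕ v) (toℕ w) → w ∈ nbhd (graph m) v
    ∈nbhd⁺ {v} = x∈tabulate-does⁺ (λ w → adjacent? (toℕ v) (toℕ w))

    ∈nbhd⁻ : ∀ {v w} → w ∈ nbhd (graph m) v → Adjacent (toℕ v) (toℕ w)
    ∈nbhd⁻ {v} = x∈tabulate-does⁻ (λ w → adjacent? (toℕ v) (toℕ w))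

    clique-isClique : IsClique (graph m) (below a)
    clique-isClique u v u∈ v∈ u≢v =
      dec-true (adjacent? (toℕ u) (toℕ v)) (inj₁ (∈below⁻ u∈ , ∈below⁻ v∈ , u≢v ∘ toℕ-injective))

    outside-independent : ∀ u v → u ∉ below a → v ∉ below a → adj (graph m) u v ≡ false
    outside-independent u v u∉ v∉ =
      dec-false (adjacent? (toℕ u) (toℕ v)) ([ u∉ ∘ ∈below⁺ , v∉ ∘ ∈below⁺ ]′ ∘ adjacent⇒<a)

    graph-isSplit : IsSplit (graph m)
    graph-isSplit = below a , clique-isClique , outside-independent

    ∣∁clique∣≤b : m ≤ a + b → ∣ ∁ (below {m} a) ∣ ≤ b
    ∣∁clique∣≤b m≤a+b = ≤-trans (toℕ-range⇒∣p∣≤u∸l (∁ (below a)) range) (≤-reflexive (m+n∸m≡n a b))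
      where
      range : ∀ {w} → w ∈ ∁ (below a) → a ≤ toℕ w × toℕ w < a + b
      range {w} w∈ = ∉below⇒≥ (x∈∁p⇒x∉p w∈) , ≤-trans (toℕ<n w) m≤a+b

    ∣∁∁clique∣≤a : ∣ ∁ (∁ (below {m} a)) ∣ ≤ a
    ∣∁∁clique∣≤a =
      toℕ-range⇒∣p∣≤u∸l (∁ (∁ (below {m} a))) (λ w∈ → z≤n , ∈below⁻ (x∉∁p⇒x∈p (x∈∁p⇒x∉p w∈)))

    -- The non-neighbours of the clique vertex v are the a + y with y in the cyclic interval
    -- base v + d, …, base v + b - 1 modulo b, which splits into these two pieces.
    nonNeighbour-gap : ∀ {v w} → v ∈ below a → w ∈ ∁ (below a) ∩ ∁ (nbhd (graph m) v) →
      a + (base (toℕ v) ∸ β) ≤ toℕ w × toℕ w < a + base (toℕ v) ⊎ a + (d + base (toℕ v)) ≤ toℕ w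
    nonNeighbour-gap {v} {w} v∈clique w∈ =
      subst (λ z → a + (c ∸ β) ≤ z × z < a + c ⊎ a + (d + c) ≤ z) (m+[n∸m]≡n a≤w)
        (Sum.map (Product.map (+-monoʳ-≤ a) (+-monoʳ-< a)) (+-monoʳ-≤ a) (¬linked⇒gap {toℕ v} ¬linked))
      where
      c = base (toℕ v)
      a≤w : a ≤ toℕ w
      a≤w = ∉below⇒≥ (x∈∁p⇒x∉p (Product.proj₁ (x∈p∩q⁻ _ _ w∈)))
      ¬linked : ¬ Linked (toℕ v) (toℕ w ∸ a)
      ¬linked linked = x∈∁p⇒x∉p (Product.proj₂ (x∈p∩q⁻ _ _ w∈))
                         (∈nbhd⁺ (inj₂ (inj₁ (∈below⁻ v∈clique , a≤w , linked))))

    nonNeighbours≤β : m ≤ a + b → ∀ {v} → v ∈ below a → ∣ ∁ (below a) ∩ ∁ (nbhd (graph m) v) ∣ ≤ β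
    nonNeighbours≤β m≤a+b {v} v∈clique = begin
      ∣ P ∣                                               ≤⟨ ∣p∣≤∣p∩q∣+∣p∩∁q∣ P (below (a + c)) ⟩
      ∣ P ∩ below (a + c) ∣ + ∣ P ∩ ∁ (below (a + c)) ∣  ≤⟨ +-mono-≤ (toℕ-range⇒∣p∣≤u∸l _ wrapped)
                                                                    (toℕ-range⇒∣p∣≤u∸l _ unwrapped) ⟩
      a + c ∸ (a + (c ∸ β)) + (a + b ∸ (a + (d + c)))    ≡⟨ cong₂ _+_ ([m+n]∸[m+o]≡n∸o a c (c ∸ β))
                                                                    (trans ([m+n]∸[m+o]≡n∸o a b (d + c))
                                                                           ([m+n]∸[m+o]≡n∸o d β c)) ⟩
      c ∸ (c ∸ β) + (β ∸ c)                              ≡⟨ m∸[m∸n]+[n∸m]≡n c β ⟩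
      β                                                  ∎
      where
      open ≤-Reasoning
      c = base (toℕ v)
      P = ∁ (below a) ∩ ∁ (nbhd (graph m) v)
      wrapped : ∀ {w} → w ∈ P ∩ below (a + c) → a + (c ∸ β) ≤ toℕ w × toℕ w < a + c
      wrapped w∈ with x∈p∩q⁻ P _ w∈
      ... | w∈P , w∈below with nonNeighbour-gap v∈clique w∈P
      ...   | inj₁ range     = range
      ...   | inj₂ a+d+c≤w = ⊥-elim (<⇒≱ (∈below⁻ w∈below) (≤-trans (+-monoʳ-≤ a (m≤n+m c d)) a+d+c≤w))
      unwrapped : ∀ {w} → w ∈ P ∩ ∁ (below (a + c)) → a + (d + c) ≤ toℕ w × toℕ w < a + b
      unwrapped {w} w∈ with x∈p∩q⁻ P _ w∈
      ... | w∈P , w∉below with nonNeighbour-gap v∈clique w∈P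
      ...   | inj₁ (_ , w<a+c) = ⊥-elim (x∈∁p⇒x∉p w∉below (∈below⁺ w<a+c))
      ...   | inj₂ a+d+c≤w     = a+d+c≤w , ≤-trans (toℕ<n w) m≤a+b

    neighbours≤α : ∀ {v} → v ∉ below a → ∣ ∁ (∁ (below a)) ∩ ∁ (nbhd (complement (graph m)) v) ∣ ≤ α
    neighbours≤α {v} v∉clique =
      increasing⇒∣p∣≤u∸l P (λ w → Slot y (toℕ w)) witness (λ _ _ → slot-increasing)
      where
      y = toℕ v ∸ a
      P = ∁ (∁ (below a)) ∩ ∁ (nbhd (complement (graph m)) v)
      joined : ∀ {w} → w ∈ P → Joined (toℕ w) (toℕ v)
      joined {w} w∈P = adjacent⇒joined (∉below⇒≥ v∉clique)
        (∈nbhd⁻ (∉nbhd-complement⇒∈nbhd (graph m) v≢w (x∈∁p⇒x∉p (Product.proj₂ (x∈p∩q⁻ _ _ w∈P)))))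
        where
        w∈clique : w ∈ below a
        w∈clique = x∉∁p⇒x∈p (x∈∁p⇒x∉p (Product.proj₁ (x∈p∩q⁻ _ _ w∈P)))
        v≢w : v ≢ w
        v≢w refl = v∉clique w∈clique
      witness : ∀ {w} → w ∈ P → ∃[ q ] Slot y (toℕ w) q × 0 ≤ q × q < α
      witness {w} w∈P with joined w∈P
      ... | w<a , _ , linked with linked⇒slot {toℕ w} linked
      ...   | q , slot = q , slot , z≤n , slot<α {y} {toℕ w} w<a slot

  graph-refutes : ∀ m → m ≤ a + b → ¬ SplitRamseyProperty k (suc a) (suc b) m
  graph-refutes m m≤a+b property with property (graph m) graph-isSplit
  ... | inj₁ (T , ∣T∣≡1+a , dense) = 1+n≰n (subst (_≤ a) ∣T∣≡1+a
    (maxDegLe⇒∣S∣≤1+k+β (complement (graph m)) outside-isClique-complement (∣∁∁clique∣≤a {m})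
       (neighbours≤α ∘ x∈∁p⇒x∉p) dense))
    where
    outside-isClique-complement : IsClique (complement (graph m)) (∁ (below a))
    outside-isClique-complement =
      isIndependent⇒isClique-complement (graph m) (∁-isIndependent (graph m) outside-independent)
  ... | inj₂ (S , ∣S∣≡1+b , sparse) = 1+n≰n (subst (_≤ b) ∣S∣≡1+b
    (maxDegLe⇒∣S∣≤1+k+β (graph m) clique-isClique (∣∁clique∣≤b m≤a+b) (nonNeighbours≤β m≤a+b) sparse))

  splitRamseyNumber : SplitRamseyNumberIs k (suc a) (suc b) (suc a + suc b ∸ 1)
  splitRamseyNumber = splitRamseyProperty-upper k (suc a) (suc b) (s≤s z≤n) ,
    λ m m<a+1+b → graph-refutes m (m<1+n⇒m≤n (subst (m <_) (+-suc a b) m<a+1+b))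

empty-graph : Graph 0
empty-graph = record { adj = λ () ; sym = λ () ; irrfl = λ () }

splitRamseyNumber-1-1 : ∀ k → SplitRamseyNumberIs k 1 1 1
splitRamseyNumber-1-1 k = splitRamseyProperty-upper k 1 1 ≤-refl , refuted
  where
  refuted : ∀ m → m < 1 → ¬ SplitRamseyProperty k 1 1 m
  refuted zero _ property with property empty-graph ([] , (λ ()) , (λ ()))
  ... | inj₁ ([] , () , _)
  ... | inj₂ ([] , () , _)
  refuted (suc m) (s≤s ())

open import Data.Integer as ℤ using (ℤ; +_; _-_; _*_; _≥_)
import Data.Integer.Properties as ℤₚ
open import Data.Nat using () renaming (_+_ to _+ℕ_)

+m-+n≡+[m∸n] : ∀ {m n} → n ≤ m → + m - + n ≡ + (m ∸ n)
+m-+n≡+[m∸n] {m} {n} n≤m = trans (ℤₚ.m-n≡m⊖n m n) (ℤₚ.⊖-≥ n≤m)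

+m-+n≡-[n∸m] : ∀ {m n} → m < n → + m - + n ≡ ℤ.- + (n ∸ m)
+m-+n≡-[n∸m] {m} {n} m<n = trans (ℤₚ.m-n≡m⊖n m n) (ℤₚ.⊖-< m<n)

+m*-n≡-[m*n] : ∀ m n → + m * ℤ.- + n ≡ ℤ.- + (m ℕ.* n)
+m*-n≡-[m*n] m n = trans (sym (ℤₚ.neg-distribʳ-* (+ m) (+ n))) (cong ℤ.-_ (sym (ℤₚ.pos-* m n)))

-m*-n≡+[m*n] : ∀ m n → ℤ.- + m * ℤ.- + n ≡ + (m ℕ.* n)
-m*-n≡+[m*n] m n = begin
  ℤ.- + m * ℤ.- + n       ≡⟨ ℤₚ.neg-distribˡ-* (+ m) (ℤ.- + n) ⟨
  ℤ.- (+ m * ℤ.- + n)     ≡⟨ cong ℤ.-_ (+m*-n≡-[m*n] m n) ⟩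
  ℤ.- ℤ.- + (m ℕ.* n)     ≡⟨ ℤₚ.neg-involutive (+ (m ℕ.* n)) ⟩
  + (m ℕ.* n)             ∎
  where open ≡-Reasoning

≤-respʳ-≡ : ∀ {x y z : ℤ} → y ≡ z → x ℤ.≤ y → x ℤ.≤ z
≤-respʳ-≡ refl x≤y = x≤y

positive≰negative : ∀ {m n} → ¬ (+ suc m ℤ.≤ ℤ.- + n)
positive≰negative {m} {n} ≤-n with ℤₚ.drop‿+≤+ (ℤₚ.≤-trans ≤-n (ℤₚ.neg-≤-pos {n} {0}))
... | ()

[1+k]²≰ : ∀ {k p q} → p ≤ k → q ≤ suc k → ¬ (suc k ℕ.* suc k ≤ p ℕ.* q)
[1+k]²≰ {k} p≤k q≤1+k [1+k]²≤pq =
  <⇒≱ (s≤s (m≤n+m (k ℕ.* suc k) k)) (≤-trans [1+k]²≤pq (*-mono-≤ p≤k q≤1+k))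

small-factors⇒1 : ∀ {i j k} → 1 ≤ i → 1 ≤ j →
  suc k ℕ.* suc k ≤ (2 +ℕ k ∸ i) ℕ.* (2 +ℕ k ∸ j) → i ≡ 1 × j ≡ 1
small-factors⇒1 {suc zero}    {suc zero}          _ _ _ = refl , refl
small-factors⇒1 {suc (suc i)} {suc j}       {k}   _ _ H =
  ⊥-elim ([1+k]²≰ (m∸n≤m k i) (m∸n≤m (suc k) j) H)
small-factors⇒1 {suc zero}    {suc (suc j)} {k}   _ _ H =
  ⊥-elim ([1+k]²≰ (m∸n≤m k j) ≤-refl (subst (suc k ℕ.* suc k ≤_) (*-comm (suc k) (k ∸ j)) H))

hypothesis-cases : ∀ {i j k} → 1 ≤ i → 1 ≤ j →
  + (suc k ℕ.* suc k) ℤ.≤ (+ i - + (2 +ℕ k)) * (+ j - + (2 +ℕ k)) →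
  (∃[ α ] ∃[ β ] i ≡ 2 +ℕ k +ℕ α × j ≡ 2 +ℕ k +ℕ β × suc k ℕ.* suc k ≤ α ℕ.* β) ⊎ i ≡ 1 × j ≡ 1
hypothesis-cases {i} {j} {k} 1≤i 1≤j H with 2 +ℕ k ≤? i | 2 +ℕ k ≤? j
... | yes c≤i | yes c≤j = inj₁ (i ∸ (2 +ℕ k) , j ∸ (2 +ℕ k) , sym (m+[n∸m]≡n c≤i) , sym (m+[n∸m]≡n c≤j) ,
  ℤₚ.drop‿+≤+ (≤-respʳ-≡ (trans (cong₂ _*_ (+m-+n≡+[m∸n] c≤i) (+m-+n≡+[m∸n] c≤j))
    (sym (ℤₚ.pos-* (i ∸ (2 +ℕ k)) (j ∸ (2 +ℕ k))))) H))
... | yes c≤i | no  c≰j = ⊥-elim (positive≰negative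
  (≤-respʳ-≡ (trans (cong₂ _*_ (+m-+n≡+[m∸n] c≤i) (+m-+n≡-[n∸m] (≰⇒> c≰j)))
    (+m*-n≡-[m*n] (i ∸ (2 +ℕ k)) (2 +ℕ k ∸ j))) H))
... | no  c≰i | yes c≤j = ⊥-elim (positive≰negative
  (≤-respʳ-≡ (trans (ℤₚ.*-comm (+ i - + (2 +ℕ k)) (+ j - + (2 +ℕ k)))
    (trans (cong₂ _*_ (+m-+n≡+[m∸n] c≤j) (+m-+n≡-[n∸m] (≰⇒> c≰i)))
      (+m*-n≡-[m*n] (j ∸ (2 +ℕ k)) (2 +ℕ k ∸ i)))) H))
... | no  c≰i | no  c≰j = inj₂ (small-factors⇒1 1≤i 1≤j
  (ℤₚ.drop‿+≤+ (≤-respʳ-≡ (trans (cong₂ _*_ (+m-+n≡-[n∸m] (≰⇒> c≰i)) (+m-+n≡-[n∸m] (≰⇒> c≰j)))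
    (-m*-n≡+[m*n] (2 +ℕ k ∸ i) (2 +ℕ k ∸ j))) H)))

theorem6p2 : (i j k : ℕ) → 1 ≤ i → 1 ≤ j →
    (+ i - + (k +ℕ 2)) * (+ j - + (k +ℕ 2)) ≥ + (k +ℕ 1) * + (k +ℕ 1) →
    SplitRamseyNumberIs k i j ((i +ℕ j) ∸ 1)
theorem6p2 i j k 1≤i 1≤j H with hypothesis-cases 1≤i 1≤j H′
  where
  H′ : + (suc k ℕ.* suc k) ℤ.≤ (+ i - + (2 +ℕ k)) * (+ j - + (2 +ℕ k))
  H′ = subst₂ (λ c e → + e * + e ℤ.≤ (+ i - + c) * (+ j - + c)) (+-comm k 2) (+-comm k 1) H
... | inj₁ (α , β , refl , refl , [1+k]²≤αβ) = Construction.splitRamseyNumber k α β [1+k]²≤αβ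
... | inj₂ (refl , refl)                     = splitRamseyNumber-1-1 k
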